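{- Let $G$ be a map on an orientable surface of genus $g$. If two Schnyder orientations of the primal-dual completion $\hat G$ have the same outdegrees and the same type with respect to some set of cycles of $G$ forming a basis for the homology, then they have the same type with respect to every set of cycles of $G$ forming a basis for the homology.
   Context: A map is a graph embedded on an orientable surface with all faces open disks, with no contractible cycles of length 1 or 2. Angle labeling: a map $\ell$ from the angles (face corners) of $G$ to $\mathbb{Z}_3$; an edge is of type 0 if its four incident angles have equal labels, of type 1/2 if in clockwise order they read $i-1,i,i,i+1$; EDGE means every edge has type 0, 1 or 2. The primal-dual completion $\hat G$ is obtained by embedding $G$ and its dual together, each edge crossing its dual once at a new vertex (edge-vertex); faces of $\hat G$ correspond to angles of $G$ and each edge of $\hat G$ joins an edge-vertex to a primal- or dual-vertex. A Schnyder orientation of $\hat G$ is one for which there is an EDGE angle labeling such that each edge of $\hat G$ separating faces (angles) $a,a'$ is oriented away from its edge-vertex iff $\ell(a)=\ell(a')$. For a directed cycle of traversal $C$ of $G$, with subdivision $\hat C$ in $\hat G$, $\gamma(C)$ = (number of edges of $\hat G$ not on $\hat C$ oriented away from a vertex of $\hat C$ on its right) $-$ (number of such edges on its left). A basis for the homology is a set of $2g$ closed walks whose classes generate the first homology group (closed-walk flows modulo the span of counterclockwise facial walks). The type of an orientation w.r.t. basis $\{B_1,\ldots,B_{2g}\}$ is $(\gamma(B_1),\ldots,\gamma(B_{2g}))$. -}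

module Defs where

open import Data.Nat using (ℕ; zero; suc; _+_; _*_; _≤_)
open import Data.Integer as ℤ using (ℤ; +_; _-_)
open import Data.Fin using (Fin; zero; suc; _≟_)
open import Data.Bool using (Bool; true; false; if_then_else_; not; _∧_)
open import Data.List using (List; []; _∷_; _++_; length; zip; allFin; map; foldr)
open import Data.List.Relation.Unary.All using (All)
open import Data.List.Relation.Unary.AllPairs using (AllPairs)
open import Data.Product using (Σ; ∃; ∃-syntax; _×_; _,_)
open import Data.Sum using (_⊎_)
open import Relation.Binary.PropositionalEquality using (_≡_; _≢_)
open import Relation.Nullary using (¬_)
open import Relation.Nullary.Decidable using (⌊_⌋)
open import Function.Bundles using (_⇔_)

iter : {A : Set} → (A → A) → ℕ → A → A
iter f zero    x = x
iter f (suc k) x = f (iter f k x)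

b2n : Bool → ℕ
b2n true  = 1
b2n false = 0

countL : {A : Set} → (A → Bool) → List A → ℕ
countL p []       = 0
countL p (x ∷ xs) = b2n (p x) + countL p xs

sumFin : (k : ℕ) → (Fin k → ℤ) → ℤ
sumFin zero    f = + 0
sumFin (suc k) f = f zero ℤ.+ sumFin k (λ i → f (suc i))

lastOf : {A : Set} → A → List A → A
lastOf x []       = x
lastOf x (y ∷ ys) = lastOf y ys

-- for a cyclic sequence c₀ … c_{k-1}: the list of pairs (c_{i-1}, c_i)
-- (indices mod k)
cycPairs : {A : Set} → List A → List (A × A)
cycPairs []       = []
cycPairs (x ∷ xs) = zip (lastOf x xs ∷ x ∷ xs) (x ∷ xs)

inc3 : Fin 3 → Fin 3
inc3 zero          = suc zero
inc3 (suc zero)    = suc (suc zero)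
inc3 (suc (suc zero)) = zero

dec3 : Fin 3 → Fin 3
dec3 zero          = suc (suc zero)
dec3 (suc zero)    = zero
dec3 (suc (suc zero)) = suc zero

-- Maps on orientable surfaces, as combinatorial maps (rotation systems).
--
-- Darts: Fin n.  α : fixed-point-free involution (the two darts of an edge).
-- σ : permutation giving the COUNTERCLOCKWISE successor of a dart around
--     its tail vertex (σ' = σ⁻¹).
-- φ d = σ⁻¹ (α d) : next dart on the boundary of the face to the LEFT of d
--     (counterclockwise facial walk).
-- vert d : tail vertex of d (vertices = σ-orbits), face d : face to the
--     left of d (faces = φ-orbits).
-- The angle (corner) "d" is the angle at vert d between d and σ d; it lies
-- in face d.  Angles are thus indexed by darts.

data Reach {n : ℕ} (σ α : Fin n → Fin n) : Fin n → Fin n → Set where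
  here  : ∀ d → Reach σ α d d
  stepσ : ∀ {d d'} → Reach σ α (σ d) d' → Reach σ α d d'
  stepα : ∀ {d d'} → Reach σ α (α d) d' → Reach σ α d d'

module RawMap (n : ℕ) (σ σ' α : Fin n → Fin n) where

  φ : Fin n → Fin n
  φ d = σ' (α d)

  faceWalk : ℕ → Fin n → List (Fin n)
  faceWalk zero    d = []
  faceWalk (suc k) d = d ∷ faceWalk k (φ d)

  -- Combinatorial free homotopy of closed walks (lists of darts):
  -- cyclic rotation, removal of a backtrack d·αd, removal of a walk
  -- going (one or more times) around a face; closed under
  -- reflexivity, symmetry and transitivity.
  data _~_ : List (Fin n) → List (Fin n) → Set where
    ~refl  : ∀ xs → xs ~ xs
    ~sym   : ∀ {xs ys} → xs ~ ys → ys ~ xs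
    ~trans : ∀ {xs ys zs} → xs ~ ys → ys ~ zs → xs ~ zs
    ~rot   : ∀ xs ys → (xs ++ ys) ~ (ys ++ xs)
    ~back  : ∀ u v d → (u ++ d ∷ α d ∷ v) ~ (u ++ v)
    ~face  : ∀ u v d k → iter φ (suc k) d ≡ d →
             (u ++ faceWalk (suc k) d ++ v) ~ (u ++ v)

  Contractible : List (Fin n) → Set
  Contractible w = w ~ []

  module WithVert {V : ℕ} (vert : Fin n → Fin V) where

    -- closed walk: head of c_{i-1} (= tail of α c_{i-1}) is tail of c_i
    IsClosedWalk : List (Fin n) → Set
    IsClosedWalk cs = All (λ pc → vert (α (Data.Product.proj₁ pc)) ≡ vert (Data.Product.proj₂ pc)) (cycPairs cs)

    IsCycle : List (Fin n) → Set
    IsCycle cs = (1 ≤ length cs) × IsClosedWalk cs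
               × AllPairs _≢_ (map vert cs)
               × AllPairs (λ a b → a ≢ b × a ≢ α b) cs

record Map : Set where
  field
    n V F : ℕ
    σ σ' α : Fin n → Fin n
    σσ' : ∀ d → σ (σ' d) ≡ d
    σ'σ : ∀ d → σ' (σ d) ≡ d
    αα  : ∀ d → α (α d) ≡ d
    αfree : ∀ d → α d ≢ d
    vert : Fin n → Fin V
    face : Fin n → Fin F
    vert-orbit : ∀ d d' → (vert d ≡ vert d') ⇔ (∃[ k ] iter σ k d ≡ d')
    face-orbit : ∀ d d' → (face d ≡ face d') ⇔ (∃[ k ] iter (RawMap.φ n σ σ' α) k d ≡ d')
    vert-onto : ∀ v → ∃[ d ] vert d ≡ v
    face-onto : ∀ f → ∃[ d ] face d ≡ f
    connected : ∀ d d' → Reach σ α d d'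
    noContractible12 : ∀ cs → RawMap.WithVert.IsCycle n σ σ' α vert cs →
                       length cs ≤ 2 → ¬ RawMap.Contractible n σ σ' α cs

module _ (M : Map) where
  open Map M
  open RawMap n σ σ' α public using (φ; faceWalk; _~_; Contractible)
  open RawMap.WithVert n σ σ' α vert public using (IsClosedWalk; IsCycle)

  Dart : Set
  Dart = Fin n

  -- genus g via Euler's formula  V - E + F = 2 - 2g,  with n = 2E darts
  Genus : ℕ → Set
  Genus g = 2 * V + 2 * F + 4 * g ≡ 4 + n

  countOcc : Fin n → List (Fin n) → ℕ
  countOcc d = countL (λ x → ⌊ x ≟ d ⌋)

  flow : List (Fin n) → Fin n → ℤ
  flow w d = + countOcc d w - + countOcc (α d) w

  facialFlow : Fin F → Fin n → ℤ
  facialFlow f d = + b2n ⌊ face d ≟ f ⌋ - + b2n ⌊ face (α d) ≟ f ⌋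

  IsCycleBasis : (g : ℕ) → (Fin (2 * g) → List (Fin n)) → Set
  IsCycleBasis g B =
    (∀ i → IsCycle (B i)) ×
    (∀ w → IsClosedWalk w →
       Σ (Fin (2 * g) → ℤ) λ c → Σ (Fin F → ℤ) λ h → ∀ d →
         flow w d ≡ sumFin (2 * g) (λ i → c i ℤ.* flow (B i) d)
                    ℤ.+ sumFin F (λ f → h f ℤ.* facialFlow f d))

  -- Edges of Ĝ: for every dart d,
  --   primalH d : joins the edge-vertex of d's edge to vert d;
  --               separates angles d and σ' d;
  --   dualH d   : joins the edge-vertex of d's edge to face d (left of d);
  --               separates angles d and σ' (α d).

  data HalfKind : Set where
    primalH dualH : HalfKind

  -- O k d = true  iff  that edge of Ĝ is oriented away from its edge-vertex
  Orientation : Set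
  Orientation = HalfKind → Fin n → Bool

  -- the four angles around the edge of d, in clockwise order:
  --   d, σ'(α d), α d, σ' d
  PatternI : Fin 3 → Fin 3 → Fin 3 → Fin 3 → Fin 3 → Set
  PatternI i a b c e = a ≡ dec3 i × b ≡ i × c ≡ i × e ≡ inc3 i

  EdgeTypeOK : Fin 3 → Fin 3 → Fin 3 → Fin 3 → Set
  EdgeTypeOK a b c e =
    (a ≡ b × b ≡ c × c ≡ e) ⊎
    (∃[ i ] (PatternI i a b c e ⊎ PatternI i b c e a ⊎
             PatternI i c e a b ⊎ PatternI i e a b c))

  EDGE : (Fin n → Fin 3) → Set
  EDGE ℓ = ∀ d → EdgeTypeOK (ℓ d) (ℓ (σ' (α d))) (ℓ (α d)) (ℓ (σ' d))

  Schnyder : Orientation → Set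
  Schnyder O = ∃[ ℓ ] (EDGE ℓ ×
    (∀ d → O primalH d ≡ ⌊ ℓ d ≟ ℓ (σ' d) ⌋) ×
    (∀ d → O dualH d ≡ ⌊ ℓ d ≟ ℓ (σ' (α d)) ⌋))

  countD : (Fin n → Bool) → ℕ
  countD p = countL p (allFin n)

  outPrimal : Orientation → Fin V → ℕ
  outPrimal O v = countD (λ d → ⌊ vert d ≟ v ⌋ ∧ not (O primalH d))

  outDual : Orientation → Fin F → ℕ
  outDual O f = countD (λ d → ⌊ face d ≟ f ⌋ ∧ not (O dualH d))

  -- outdegree of the edge-vertex of the edge of d
  outEdge : Orientation → Fin n → ℕ
  outEdge O d = b2n (O primalH d) + b2n (O primalH (α d))
              + b2n (O dualH d) + b2n (O dualH (α d))

  SameOutdeg : Orientation → Orientation → Set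
  SameOutdeg O O' = (∀ v → outPrimal O v ≡ outPrimal O' v)
                  × (∀ f → outDual O f ≡ outDual O' f)
                  × (∀ d → outEdge O d ≡ outEdge O' d)

  between : ℕ → Fin n → Fin n → List (Fin n)
  between zero    a b = []
  between (suc k) a b with ⌊ σ a ≟ b ⌋
  ... | true  = []
  ... | false = σ a ∷ between k (σ a) b

  -- contribution of consecutive darts p = c_{i-1}, c = c_i :
  -- edges of Ĝ leaving vert c (other than c, α p) and leaving the
  -- edge-vertex of c (dual ones); right count minus left count
  γstep : Orientation → Fin n × Fin n → ℤ
  γstep O (p , c) =
      + (countL (λ d → not (O primalH d)) (between n (α p) c) + b2n (O dualH (α c)))
    - + (countL (λ d → not (O primalH d)) (between n c (α p)) + b2n (O dualH c))

  γ : Orientation → List (Fin n) → ℤ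
  γ O cs = foldr ℤ._+_ (+ 0) (map (γstep O) (cycPairs cs))

  SameType : (g : ℕ) → Orientation → Orientation → (Fin (2 * g) → List (Fin n)) → Set
  SameType g O O' B = ∀ i → γ O (B i) ≡ γ O' (B i)

module Submission where

open import Defs

-- Let O₁, O₂ be orientations of the primal-dual completion with the same
-- outdegrees.  The proof constructs a weight κ on darts with
--   (1) γ O₁ w − γ O₂ w = ⟨ flow w , κ ⟩  for every closed walk w, and
--   (2) ⟨ facial flow of f , κ ⟩ = 0  for every face f.
-- Hence  w ↦ γ O₁ w − γ O₂ w  is a linear function of the homology class of w.
-- If it vanishes on one basis, it vanishes on every closed walk, in particular
-- on the cycles of any other basis.
--
-- κ comes from a potential: equal outdegrees at primal vertices make the
-- changes δp of the primal edges sum to zero around each vertex, so partial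
-- sums of δp around a vertex are differences of a potential P (module
-- Potential); κ = 2P + δp − δd, where δd records the changes of dual edges.
-- Equal outdegrees at edge-vertices relate P on the two sides of an edge, and
-- equal outdegrees at dual vertices then give (2).

module Proof where
  open import Data.Nat as ℕ using (ℕ; zero; suc; s≤s)
  import Data.Nat.Properties as ℕ
  open import Data.Integer using (ℤ; +_; _+_; _-_; -_; _*_)
  import Data.Integer.Properties as ℤ
  open import Data.Integer.Tactic.RingSolver using (solve-∀)
  open import Data.Fin using (Fin; zero; suc; _≟_; toℕ)
  open import Data.Fin.Properties using (suc-injective; pigeonhole; toℕ≤pred[n])
  import Data.Fin.Permutation as Perm
  import Algebra.Properties.CommutativeMonoid.Sum as CommutativeMonoidSum
  open import Data.Bool using (Bool; true; false; not; _∧_; if_then_else_)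
  open import Data.List using (List; []; _∷_; map; foldr; zip; tabulate; allFin)
  open import Data.List.Relation.Unary.All using (All; []; _∷_)
  open import Data.Product using (Σ; _×_; _,_; proj₁; proj₂)
  open import Data.Empty using (⊥-elim)
  open import Function using (_∘_; id)
  open import Function.Bundles using (Equivalence)
  open import Relation.Binary.PropositionalEquality
  open import Relation.Nullary using (yes; no)
  open import Relation.Nullary.Decidable using (⌊_⌋)

  module FiniteSums where

    sum-cong : ∀ k {f g : Fin k → ℤ} → (∀ i → f i ≡ g i) → sumFin k f ≡ sumFin k g
    sum-cong zero    f≗g = refl
    sum-cong (suc k) f≗g = cong₂ _+_ (f≗g zero) (sum-cong k (f≗g ∘ suc))

    sum-zero : ∀ k → sumFin k (λ _ → + 0) ≡ + 0
    sum-zero zero    = refl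
    sum-zero (suc k) = trans (ℤ.+-identityˡ _) (sum-zero k)

    sum-+ : ∀ k (f g : Fin k → ℤ) → sumFin k (λ i → f i + g i) ≡ sumFin k f + sumFin k g
    sum-+ zero    f g = refl
    sum-+ (suc k) f g =
      trans (cong (λ s → (f zero + g zero) + s) (sum-+ k (f ∘ suc) (g ∘ suc))) (interchange (f zero) (g zero) _ _)
      where interchange : ∀ a b c d → (a + b) + (c + d) ≡ (a + c) + (b + d)
            interchange = solve-∀

    sum-- : ∀ k (f g : Fin k → ℤ) → sumFin k (λ i → f i - g i) ≡ sumFin k f - sumFin k g
    sum-- zero    f g = refl
    sum-- (suc k) f g =
      trans (cong (λ s → (f zero - g zero) + s) (sum-- k (f ∘ suc) (g ∘ suc))) (interchange (f zero) (g zero) _ _)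
      where interchange : ∀ a b c d → (a - b) + (c - d) ≡ (a + c) - (b + d)
            interchange = solve-∀

    sum-*ˡ : ∀ k c (f : Fin k → ℤ) → sumFin k (λ i → c * f i) ≡ c * sumFin k f
    sum-*ˡ zero    c f = sym (ℤ.*-zeroʳ c)
    sum-*ˡ (suc k) c f =
      trans (cong (λ s → c * f zero + s) (sum-*ˡ k c (f ∘ suc))) (sym (ℤ.*-distribˡ-+ c (f zero) _))

    sum-comm : ∀ m k (f : Fin m → Fin k → ℤ) →
               sumFin m (λ i → sumFin k (f i)) ≡ sumFin k (λ j → sumFin m (λ i → f i j))
    sum-comm zero    k f = sym (sum-zero k)
    sum-comm (suc m) k f =
      trans (cong (λ s → sumFin k (f zero) + s) (sum-comm m k (f ∘ suc)))
            (sym (sum-+ k (f zero) (λ j → sumFin m (λ i → f (suc i) j))))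

    sum-single : ∀ k (c : Fin k) (f : Fin k → ℤ) → (∀ i → i ≢ c → f i ≡ + 0) → sumFin k f ≡ f c
    sum-single (suc k) zero f vanish =
      trans (cong (λ s → f zero + s) (trans (sum-cong k (λ i → vanish (suc i) λ ())) (sum-zero k)))
            (ℤ.+-identityʳ (f zero))
    sum-single (suc k) (suc c) f vanish =
      trans (cong₂ _+_ (vanish zero λ ())
                       (sum-single k c (f ∘ suc) (λ i i≢c → vanish (suc i) (i≢c ∘ suc-injective))))
            (ℤ.+-identityˡ (f (suc c)))

    sum-permute : ∀ k (π π⁻¹ : Fin k → Fin k) → (∀ i → π (π⁻¹ i) ≡ i) → (∀ i → π⁻¹ (π i) ≡ i) →
                  ∀ (f : Fin k → ℤ) → sumFin k (f ∘ π) ≡ sumFin k f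
    sum-permute k π π⁻¹ inv₁ inv₂ f =
      trans (sumFin≡sum (f ∘ π))
            (trans (sym (Σℤ.sum-permute f (Perm.permutation π π⁻¹ inv₁ inv₂))) (sym (sumFin≡sum f)))
      where
      module Σℤ = CommutativeMonoidSum ℤ.+-0-commutativeMonoid
      sumFin≡sum : ∀ {k} (f : Fin k → ℤ) → sumFin k f ≡ Σℤ.sum f
      sumFin≡sum {zero}  f = refl
      sumFin≡sum {suc k} f = cong (λ s → f zero + s) (sumFin≡sum (f ∘ suc))

    ind : ∀ {k} → Fin k → Fin k → ℤ
    ind x y = + b2n ⌊ x ≟ y ⌋

    ind-refl : ∀ {k} (x : Fin k) → ind x x ≡ + 1
    ind-refl x with x ≟ x
    ... | yes _  = refl
    ... | no x≢x = ⊥-elim (x≢x refl)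

    ind-≢ : ∀ {k} {x y : Fin k} → x ≢ y → ind x y ≡ + 0
    ind-≢ {x = x} {y} x≢y with x ≟ y
    ... | yes x≡y = ⊥-elim (x≢y x≡y)
    ... | no _    = refl

    sum-indˡ : ∀ k (c : Fin k) (f : Fin k → ℤ) → sumFin k (λ i → ind c i * f i) ≡ f c
    sum-indˡ k c f =
      trans (sum-single k c _ (λ i i≢c → cong (_* f i) (ind-≢ (i≢c ∘ sym))))
            (trans (cong (_* f c) (ind-refl c)) (ℤ.*-identityˡ (f c)))

    sum-indʳ : ∀ k (c : Fin k) (f : Fin k → ℤ) → sumFin k (λ i → ind i c * f i) ≡ f c
    sum-indʳ k c f =
      trans (sum-single k c _ (λ i i≢c → cong (_* f i) (ind-≢ i≢c)))
            (trans (cong (_* f c) (ind-refl c)) (ℤ.*-identityˡ (f c)))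

    count-allFin : ∀ k (p : Fin k → Bool) → + countL p (allFin k) ≡ sumFin k (λ i → + b2n (p i))
    count-allFin k p = count-tabulate k id
      where
      count-tabulate : ∀ k (f : Fin k → Fin _) → + countL p (tabulate f) ≡ sumFin k (λ i → + b2n (p (f i)))
      count-tabulate zero    f = refl
      count-tabulate (suc k) f =
        trans (ℤ.pos-+ (b2n (p (f zero))) _) (cong (λ s → + b2n (p (f zero)) + s) (count-tabulate k (f ∘ suc)))

    ⟨_,_⟩ : ∀ {k} → (Fin k → ℤ) → (Fin k → ℤ) → ℤ
    ⟨_,_⟩ {k} a b = sumFin k (λ i → a i * b i)

    ⟨⟩-cong : ∀ {k} {a a' : Fin k → ℤ} (b : Fin k → ℤ) → (∀ i → a i ≡ a' i) → ⟨ a , b ⟩ ≡ ⟨ a' , b ⟩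
    ⟨⟩-cong {k} b a≗a' = sum-cong k (λ i → cong (_* b i) (a≗a' i))

    ⟨⟩-+ : ∀ {k} (a a' b : Fin k → ℤ) → ⟨ (λ i → a i + a' i) , b ⟩ ≡ ⟨ a , b ⟩ + ⟨ a' , b ⟩
    ⟨⟩-+ {k} a a' b = trans (sum-cong k (λ i → ℤ.*-distribʳ-+ (b i) (a i) (a' i))) (sum-+ k _ _)

    ⟨⟩-antisym : ∀ k (α : Fin k → Fin k) → (∀ i → α (α i) ≡ i) → ∀ (a b : Fin k → ℤ) →
                 ⟨ (λ i → a i - a (α i)) , b ⟩ ≡ ⟨ a , (λ i → b i - b (α i)) ⟩
    ⟨⟩-antisym k α αα a b = begin
        sumFin k (λ i → (a i - a (α i)) * b i)
      ≡⟨ trans (sum-cong k (λ i → distribʳ (a i) (a (α i)) (b i))) (sum-- k _ _) ⟩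
        sumFin k (λ i → a i * b i) - sumFin k (λ i → a (α i) * b i)
      ≡⟨ cong (λ s → sumFin k (λ i → a i * b i) - s) reindex ⟩
        sumFin k (λ i → a i * b i) - sumFin k (λ i → a i * b (α i))
      ≡⟨ sym (trans (sum-cong k (λ i → distribˡ (a i) (b i) (b (α i)))) (sum-- k _ _)) ⟩
        sumFin k (λ i → a i * (b i - b (α i))) ∎
      where
      open ≡-Reasoning
      distribʳ : ∀ x y z → (x - y) * z ≡ x * z - y * z
      distribʳ = solve-∀
      distribˡ : ∀ x y z → x * (y - z) ≡ x * y - x * z
      distribˡ = solve-∀
      reindex : sumFin k (λ i → a (α i) * b i) ≡ sumFin k (λ i → a i * b (α i))
      reindex = trans (sum-cong k (λ i → cong (λ j → a (α i) * b j) (sym (αα i))))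
                      (sum-permute k α α αα αα (λ j → a j * b (α j)))

    ⟨⟩-combination-zero : ∀ {k} m (c : Fin m → ℤ) (a : Fin m → Fin k → ℤ) (b : Fin k → ℤ) →
                          (∀ j → ⟨ a j , b ⟩ ≡ + 0) → ⟨ (λ i → sumFin m (λ j → c j * a j i)) , b ⟩ ≡ + 0
    ⟨⟩-combination-zero {k} m c a b orth = begin
        sumFin k (λ i → sumFin m (λ j → c j * a j i) * b i)
      ≡⟨ sum-cong k (λ i → sym (sum-*ʳ m (b i) (λ j → c j * a j i))) ⟩
        sumFin k (λ i → sumFin m (λ j → c j * a j i * b i))
      ≡⟨ sym (sum-comm m k (λ j i → c j * a j i * b i)) ⟩
        sumFin m (λ j → sumFin k (λ i → c j * a j i * b i))
      ≡⟨ sum-cong m (λ j → trans (sum-cong k (λ i → ℤ.*-assoc (c j) (a j i) (b i))) (sum-*ˡ k (c j) _)) ⟩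
        sumFin m (λ j → c j * ⟨ a j , b ⟩)
      ≡⟨ sum-cong m (λ j → trans (cong (c j *_) (orth j)) (ℤ.*-zeroʳ (c j))) ⟩
        sumFin m (λ _ → + 0)
      ≡⟨ sum-zero m ⟩
        + 0 ∎
      where
      open ≡-Reasoning
      sum-*ʳ : ∀ m x (f : Fin m → ℤ) → sumFin m (λ j → f j * x) ≡ sumFin m f * x
      sum-*ʳ m x f = trans (sum-cong m (λ j → ℤ.*-comm (f j) x)) (trans (sum-*ˡ m x f) (ℤ.*-comm x _))

    class-balanced : ∀ k {m} (cls : Fin k → Fin m) (x : Fin m) (a b : Fin k → Bool) →
                     countL (λ i → ⌊ cls i ≟ x ⌋ ∧ a i) (allFin k) ≡ countL (λ i → ⌊ cls i ≟ x ⌋ ∧ b i) (allFin k) →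
                     sumFin k (λ i → ind (cls i) x * (+ b2n (a i) - + b2n (b i))) ≡ + 0
    class-balanced k cls x a b same-count = begin
        sumFin k (λ i → ind (cls i) x * (+ b2n (a i) - + b2n (b i)))
      ≡⟨ trans (sum-cong k (λ i → masked ⌊ cls i ≟ x ⌋ (a i) (b i))) (sum-- k _ _) ⟩
        sumFin k (λ i → + b2n (⌊ cls i ≟ x ⌋ ∧ a i)) - sumFin k (λ i → + b2n (⌊ cls i ≟ x ⌋ ∧ b i))
      ≡⟨ cong₂ _-_ (sym (count-allFin k _)) (sym (count-allFin k _)) ⟩
        + countL (λ i → ⌊ cls i ≟ x ⌋ ∧ a i) (allFin k) - + countL (λ i → ⌊ cls i ≟ x ⌋ ∧ b i) (allFin k)
      ≡⟨ ℤ.i≡j⇒i-j≡0 (cong +_ same-count) ⟩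
        + 0 ∎
      where
      open ≡-Reasoning
      masked : ∀ c a b → + b2n c * (+ b2n a - + b2n b) ≡ + b2n (c ∧ a) - + b2n (c ∧ b)
      masked true  a b = ℤ.*-identityˡ _
      masked false a b = refl

  open FiniteSums

  module ListSums where

    ΣL : ∀ {A : Set} → (A → ℤ) → List A → ℤ
    ΣL f xs = foldr _+_ (+ 0) (map f xs)

    ΣL-cong : ∀ {A : Set} {f g : A → ℤ} → (∀ x → f x ≡ g x) → ∀ xs → ΣL f xs ≡ ΣL g xs
    ΣL-cong f≗g []       = refl
    ΣL-cong f≗g (x ∷ xs) = cong₂ _+_ (f≗g x) (ΣL-cong f≗g xs)

    ΣL-cong-All : ∀ {A : Set} {P : A → Set} {f g : A → ℤ} {xs} →
                  All P xs → (∀ x → P x → f x ≡ g x) → ΣL f xs ≡ ΣL g xs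
    ΣL-cong-All []         f≗g = refl
    ΣL-cong-All (px ∷ pxs) f≗g = cong₂ _+_ (f≗g _ px) (ΣL-cong-All pxs f≗g)

    ΣL-- : ∀ {A : Set} (f g : A → ℤ) xs → ΣL f xs - ΣL g xs ≡ ΣL (λ x → f x - g x) xs
    ΣL-- f g []       = refl
    ΣL-- f g (x ∷ xs) =
      trans (interchange (f x) (g x) (ΣL f xs) (ΣL g xs)) (cong (λ s → (f x - g x) + s) (ΣL-- f g xs))
      where interchange : ∀ a b c d → (a + c) - (b + d) ≡ (a - b) + (c - d)
            interchange = solve-∀

    count-ΣL : ∀ {A : Set} (p : A → Bool) xs → + countL p xs ≡ ΣL (λ x → + b2n (p x)) xs
    count-ΣL p []       = refl
    count-ΣL p (x ∷ xs) = trans (ℤ.pos-+ (b2n (p x)) _) (cong (λ s → + b2n (p x) + s) (count-ΣL p xs))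

    -- Telescoping around a cyclic sequence: each element occurs once as the second
    -- and once as the first component of a pair in cycPairs.
    ΣL-cycPairs : ∀ {A : Set} (u w : A → ℤ) xs →
                  ΣL (λ pc → u (proj₂ pc) - w (proj₁ pc)) (cycPairs xs) ≡ ΣL (λ x → u x - w x) xs
    ΣL-cycPairs u w []       = refl
    ΣL-cycPairs u w (x ∷ xs) =
      trans (shifted (lastOf x xs) x xs) (cancel (ΣL (λ x → u x - w x) (x ∷ xs)) (w (lastOf x xs)))
      where
      cancel : ∀ s t → s + (t - t) ≡ s
      cancel = solve-∀
      shifted : ∀ y x xs → ΣL (λ pc → u (proj₂ pc) - w (proj₁ pc)) (zip (y ∷ x ∷ xs) (x ∷ xs))
                           ≡ ΣL (λ x → u x - w x) (x ∷ xs) + (w (lastOf x xs) - w y)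
      shifted y x []       = regroup (u x) (w y) (w x)
        where regroup : ∀ a b c → (a - b) + + 0 ≡ ((a - c) + + 0) + (c - b)
              regroup = solve-∀
      shifted y x (z ∷ zs) =
        trans (cong (λ s → (u x - w y) + s) (shifted x z zs))
              (regroup (u x) (w y) (w x) (ΣL (λ x → u x - w x) (z ∷ zs)) (w (lastOf z zs)))
        where regroup : ∀ a b c s e → (a - b) + (s + (e - c)) ≡ ((a - c) + s) + (e - b)
              regroup = solve-∀

    sum-occurrences : ∀ k (xs : List (Fin k)) (f : Fin k → ℤ) →
                      sumFin k (λ d → + countL (λ x → ⌊ x ≟ d ⌋) xs * f d) ≡ ΣL f xs
    sum-occurrences k []       f = trans (sum-cong k (λ d → ℤ.*-zeroˡ (f d))) (sum-zero k)
    sum-occurrences k (x ∷ xs) f = begin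
        sumFin k (λ d → + countL (λ y → ⌊ y ≟ d ⌋) (x ∷ xs) * f d)
      ≡⟨ sum-cong k (λ d → trans (cong (_* f d) (ℤ.pos-+ (b2n ⌊ x ≟ d ⌋) _))
                                 (ℤ.*-distribʳ-+ (f d) (ind x d) (+ countL (λ y → ⌊ y ≟ d ⌋) xs))) ⟩
        sumFin k (λ d → ind x d * f d + + countL (λ y → ⌊ y ≟ d ⌋) xs * f d)
      ≡⟨ sum-+ k _ _ ⟩
        sumFin k (λ d → ind x d * f d) + sumFin k (λ d → + countL (λ y → ⌊ y ≟ d ⌋) xs * f d)
      ≡⟨ cong₂ _+_ (sum-indˡ k x f) (sum-occurrences k xs f) ⟩
        f x + ΣL f xs ∎
      where open ≡-Reasoning

  open ListSums

  -- The one fact needed later is its one-step unfolding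
  -- (between-step), which holds because b is reached from a within n steps.

  module Rotation (M : Map) where
    open Map M

    iter-shift : ∀ k x → iter σ (suc k) x ≡ iter σ k (σ x)
    iter-shift zero    x = refl
    iter-shift (suc k) x = cong σ (iter-shift k x)

    iter-+ : ∀ i j x → iter σ (i ℕ.+ j) x ≡ iter σ i (iter σ j x)
    iter-+ zero    j x = refl
    iter-+ (suc i) j x = cong σ (iter-+ i j x)

    iter-injective : ∀ i {x y} → iter σ i x ≡ iter σ i y → x ≡ y
    iter-injective zero    eq = eq
    iter-injective (suc i) eq = iter-injective i (trans (sym (σ'σ _)) (trans (cong σ' eq) (σ'σ _)))

    vert-iter : ∀ k d → vert (iter σ k d) ≡ vert d
    vert-iter k d = sym (Equivalence.from (vert-orbit d (iter σ k d)) (k , refl))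

    -- by pigeonhole among a, σ a, …, σⁿ a, every dart has a period 1 ≤ p ≤ n
    period : ∀ a → Σ ℕ λ p → 1 ℕ.≤ p × p ℕ.≤ n × iter σ p a ≡ a
    period a with pigeonhole (ℕ.n<1+n n) (λ (i : Fin (suc n)) → iter σ (toℕ i) a)
    ... | i , j , i<j , σⁱa≡σʲa =
      toℕ j ℕ.∸ toℕ i , ℕ.m<n⇒0<n∸m i<j ,
      ℕ.≤-trans (ℕ.m∸n≤m (toℕ j) (toℕ i)) (toℕ≤pred[n] j) ,
      iter-injective (toℕ i) (trans (sym (iter-+ (toℕ i) _ a))
        (trans (cong (λ m → iter σ m a) (ℕ.m+[n∸m]≡n (ℕ.<⇒≤ i<j))) (sym σⁱa≡σʲa)))

    reduce-mod : ∀ p a → 1 ℕ.≤ p → iter σ p a ≡ a →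
                 ∀ k → Σ ℕ λ h → h ℕ.< p × iter σ (suc h) a ≡ iter σ k a
    reduce-mod (suc p) a _ σᵖa≡a zero = p , ℕ.≤-refl , σᵖa≡a
    reduce-mod p a 1≤p σᵖa≡a (suc k) with reduce-mod p a 1≤p σᵖa≡a k
    ... | h , h<p , eq with suc h ℕ.<? p
    ...   | yes 1+h<p = suc h , 1+h<p , cong σ eq
    ...   | no  1+h≮p = 0 , 1≤p , cong σ (trans (sym σᵖa≡a) (trans (cong (λ m → iter σ m a) (sym 1+h≡p)) eq))
      where 1+h≡p : suc h ≡ p
            1+h≡p = ℕ.≤-antisym h<p (ℕ.≮⇒≥ 1+h≮p)

    reach-within : ∀ a b → vert a ≡ vert b → Σ ℕ λ h → h ℕ.< n × iter σ (suc h) a ≡ b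
    reach-within a b a~b with period a | Equivalence.to (vert-orbit a b) a~b
    ... | p , 1≤p , p≤n , σᵖa≡a | k , σᵏa≡b with reduce-mod p a 1≤p σᵖa≡a k
    ...   | h , h<p , eq = h , ℕ.<-≤-trans h<p p≤n , trans eq σᵏa≡b

    between-fuel : ∀ j k x b → iter σ (suc j) x ≡ b → j ℕ.< k → between M k x b ≡ between M (suc j) x b
    between-fuel zero (suc k) x b σx≡b _ with σ x ≟ b
    ... | yes _    = refl
    ... | no σx≢b = ⊥-elim (σx≢b σx≡b)
    between-fuel (suc j) (suc (suc k)) x b eq (s≤s j<k) with σ x ≟ b
    ... | yes _ = refl
    ... | no _  = cong (σ x ∷_) (between-fuel j (suc k) (σ x) b (trans (sym (iter-shift (suc j) x)) eq) j<k)

    between-step : ∀ e b → vert e ≡ vert b →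
                   between M n e b ≡ (if ⌊ σ e ≟ b ⌋ then [] else σ e ∷ between M n (σ e) b)
    between-step e b e~b with reach-within e b e~b
    ... | h , h<n , eq = trans (between-fuel h n e b eq h<n) (unfold h eq h<n)
      where
      unfold : ∀ h → iter σ (suc h) e ≡ b → h ℕ.< n →
               between M (suc h) e b ≡ (if ⌊ σ e ≟ b ⌋ then [] else σ e ∷ between M n (σ e) b)
      unfold h eq h<n with σ e ≟ b
      ... | yes _ = refl
      unfold zero    eq h<n | no σe≢b = ⊥-elim (σe≢b eq)
      unfold (suc h) eq h<n | no _    =
        cong (σ e ∷_) (sym (between-fuel h n (σ e) b (trans (sym (iter-shift (suc h) e)) eq)
                                          (ℕ.<-trans (ℕ.n<1+n h) h<n)))

    between-σ : ∀ e → between M n e (σ e) ≡ []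
    between-σ e rewrite between-step e (σ e) (sym (vert-iter 1 e)) with σ e ≟ σ e
    ... | yes _   = refl
    ... | no σe≢σe = ⊥-elim (σe≢σe refl)

  module Potential (M : Map) (δ : Dart M → ℤ)
                   (balanced : ∀ v → sumFin (Map.n M) (λ d → ind (Map.vert M d) v * δ d) ≡ + 0) where
    open Map M
    open Rotation M

    Q : Dart M → Dart M → ℤ
    Q a b = δ a + ΣL δ (between M n a b)

    Q-unfold : ∀ e b → vert e ≡ vert b → Q e b ≡ δ e + (if ⌊ σ e ≟ b ⌋ then + 0 else Q (σ e) b)
    Q-unfold e b e~b rewrite between-step e b e~b with ⌊ σ e ≟ b ⌋
    ... | true  = refl
    ... | false = refl

    -- a full turn around a vertex: sum Q d b over all darts d at the vertex of b,
    -- unfold one step and reindex by σ; what remains is Q b b = ∑ δ = 0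
    Q-full-turn : ∀ b → Q b b ≡ + 0
    Q-full-turn b = solve-for (Q b b) total-eq
      where
      open ≡-Reasoning
      v : Fin V
      v = vert b
      at-v : Dart M → ℤ
      at-v d = ind (vert d) v
      rest : Dart M → ℤ
      rest e = if ⌊ e ≟ b ⌋ then + 0 else Q e b
      total : ℤ
      total = sumFin n (λ d → at-v d * Q d b)

      unfold-at-v : ∀ d → at-v d * Q d b ≡ at-v d * δ d + at-v (σ d) * rest (σ d)
      unfold-at-v d rewrite vert-iter 1 d with vert d ≟ v
      ... | yes d~b rewrite Q-unfold d b d~b = distrib (δ d) (rest (σ d))
        where distrib : ∀ x y → + 1 * (x + y) ≡ + 1 * x + + 1 * y
              distrib = solve-∀
      ... | no _ = refl

      rest-at-v : ∀ e → at-v e * rest e ≡ at-v e * Q e b - ind e b * Q e b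
      rest-at-v e with e ≟ b
      ... | yes refl = cancel (ind-refl (vert e)) (Q e e)
        where cancel : ∀ {i} → i ≡ + 1 → ∀ q → i * + 0 ≡ i * q - + 1 * q
              cancel refl = solve-∀
      ... | no _ = sym (ℤ.+-identityʳ _)

      total-eq : total ≡ + 0 + (total - Q b b)
      total-eq = begin
          total
        ≡⟨ trans (sum-cong n unfold-at-v) (sum-+ n _ _) ⟩
          sumFin n (λ d → at-v d * δ d) + sumFin n (λ d → at-v (σ d) * rest (σ d))
        ≡⟨ cong₂ _+_ (balanced v) (sum-permute n σ σ' σσ' σ'σ (λ e → at-v e * rest e)) ⟩
          + 0 + sumFin n (λ e → at-v e * rest e)
        ≡⟨ cong (λ s → + 0 + s) (trans (sum-cong n rest-at-v) (sum-- n _ _)) ⟩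
          + 0 + (total - sumFin n (λ e → ind e b * Q e b))
        ≡⟨ cong (λ s → + 0 + (total - s)) (sum-indʳ n b (λ e → Q e b)) ⟩
          + 0 + (total - Q b b) ∎

      solve-for : ∀ q → total ≡ + 0 + (total - q) → q ≡ + 0
      solve-for q eq = trans (isolate total q) (trans (cong (λ s → total - s) (sym eq)) (ℤ.+-inverseʳ total))
        where isolate : ∀ a q → q ≡ a - (+ 0 + (a - q))
              isolate = solve-∀

    -- one rotation step, uniformly (using Q b b = 0 when σ e = b)
    Q-step : ∀ e b → vert e ≡ vert b → Q e b ≡ δ e + Q (σ e) b
    Q-step e b e~b rewrite Q-unfold e b e~b with σ e ≟ b
    ... | yes refl = cong (λ s → δ e + s) (sym (Q-full-turn (σ e)))
    ... | no _     = refl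

    -- additivity of partial sums around a vertex (the sum over a full turn being 0)
    Q-cocycle : ∀ a b z → vert a ≡ vert b → vert z ≡ vert b → Q a b ≡ Q a z - Q b z
    Q-cocycle a b z a~b z~b =
      trans (split (Q a b) (Q a z)) (trans (cong (_+ Q a z) g-at-a) (regroup (Q b z) (Q a z)))
      where
      g : Dart M → ℤ
      g e = Q e b - Q e z
      g-step : ∀ e → vert e ≡ vert b → g e ≡ g (σ e)
      g-step e e~b rewrite Q-step e b e~b | Q-step e z (trans e~b (sym z~b)) =
        cancel (δ e) (Q (σ e) b) (Q (σ e) z)
        where cancel : ∀ d x y → (d + x) - (d + y) ≡ x - y
              cancel = solve-∀
      g-orbit : ∀ k → g (iter σ k b) ≡ g b
      g-orbit zero    = refl
      g-orbit (suc k) = trans (sym (g-step (iter σ k b) (vert-iter k b))) (g-orbit k)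
      g-at-a : Q a b - Q a z ≡ + 0 - Q b z
      g-at-a with Equivalence.to (vert-orbit b a) (sym a~b)
      ... | k , σᵏb≡a = trans (cong g (sym σᵏb≡a)) (trans (g-orbit k) (cong (_- Q b z) (Q-full-turn b)))
      split : ∀ x y → x ≡ (x - y) + y
      split = solve-∀
      regroup : ∀ y x → (+ 0 - y) + x ≡ x - y
      regroup = solve-∀

    base : Dart M → Dart M
    base d = proj₁ (vert-onto (vert d))

    P : Dart M → ℤ
    P d = - Q d (base d)

    between-sum : ∀ a b → vert a ≡ vert b → ΣL δ (between M n a b) ≡ P b - P a - δ a
    between-sum a b a~b = begin
        ΣL δ (between M n a b)
      ≡⟨ peel (δ a) _ ⟩
        Q a b - δ a
      ≡⟨ cong (_- δ a) (Q-cocycle a b (base b) a~b (proj₂ (vert-onto (vert b)))) ⟩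
        (Q a (base b) - Q b (base b)) - δ a
      ≡⟨ cong (λ z → (Q a z - Q b (base b)) - δ a) (sym same-base) ⟩
        (Q a (base a) - Q b (base b)) - δ a
      ≡⟨ regroup (Q a (base a)) (Q b (base b)) (δ a) ⟩
        P b - P a - δ a ∎
      where
      open ≡-Reasoning
      same-base : base a ≡ base b
      same-base = cong (λ v → proj₁ (vert-onto v)) a~b
      peel : ∀ d s → s ≡ (d + s) - d
      peel = solve-∀
      regroup : ∀ x y d → (x - y) - d ≡ - y - (- x) - d
      regroup = solve-∀

  cycle-closed : (M : Map) → ∀ {w} → IsCycle M w → IsClosedWalk M w
  cycle-closed M (_ , closed , _) = closed

  module Comparison (M : Map) (O₁ O₂ : Orientation M) (same-out : SameOutdeg M O₁ O₂) where
    open Map M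
    open Rotation M

    -- change in whether the primal edge of Ĝ at d leaves vert d (points to the edge-vertex)
    δp : Dart M → ℤ
    δp d = + b2n (not (O₁ primalH d)) - + b2n (not (O₂ primalH d))

    δd : Dart M → ℤ
    δd d = + b2n (O₁ dualH d) - + b2n (O₂ dualH d)

    vertex-balanced : ∀ v → sumFin n (λ d → ind (vert d) v * δp d) ≡ + 0
    vertex-balanced v =
      class-balanced n vert v (λ d → not (O₁ primalH d)) (λ d → not (O₂ primalH d)) (proj₁ same-out v)

    face-balanced : ∀ f → sumFin n (λ d → ind (face d) f * δd d) ≡ + 0
    face-balanced f =
      trans (sum-cong n (λ d → cong (ind (face d) f *_) (flip-not (O₁ dualH d) (O₂ dualH d))))
            (class-balanced n face f (λ d → not (O₂ dualH d)) (λ d → not (O₁ dualH d))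
                            (sym (proj₁ (proj₂ same-out) f)))
      where flip-not : ∀ x y → + b2n x - + b2n y ≡ + b2n (not y) - + b2n (not x)
            flip-not true  true  = refl
            flip-not true  false = refl
            flip-not false true  = refl
            flip-not false false = refl

    -- conservation at the edge-vertex of d, which has the four edges of Ĝ at d and α d
    edge-balanced : ∀ d → δd (α d) ≡ δp d + δp (α d) - δd d
    edge-balanced d =
      trans (four-balance (b O₁ primalH d) (b O₁ primalH (α d)) (b O₁ dualH d) (b O₁ dualH (α d))
                          (b O₂ primalH d) (b O₂ primalH (α d)) (b O₂ dualH d) (b O₂ dualH (α d)) same-total)
            (sym (cong₂ (λ x y → x + y - δd d) (δp-as d) (δp-as (α d))))
      where
      b : Orientation M → HalfKind M → Dart M → ℤ
      b O k e = + b2n (O k e)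
      total : Orientation M → ℤ
      total O = b O primalH d + b O primalH (α d) + b O dualH d + b O dualH (α d)
      outEdge-ℤ : ∀ O → + outEdge M O d ≡ total O
      outEdge-ℤ O = trans (ℤ.pos-+ _ (b2n (O dualH (α d))))
                     (cong (_+ b O dualH (α d)) (trans (ℤ.pos-+ _ (b2n (O dualH d)))
                       (cong (_+ b O dualH d) (ℤ.pos-+ (b2n (O primalH d)) _))))
      same-total : total O₁ ≡ total O₂
      same-total = trans (sym (outEdge-ℤ O₁)) (trans (cong +_ (proj₂ (proj₂ same-out) d)) (outEdge-ℤ O₂))
      b2n-not : ∀ x → + b2n (not x) ≡ + 1 - + b2n x
      b2n-not true  = refl
      b2n-not false = refl
      δp-as : ∀ e → δp e ≡ (+ 1 - b O₁ primalH e) - (+ 1 - b O₂ primalH e)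
      δp-as e = cong₂ _-_ (b2n-not (O₁ primalH e)) (b2n-not (O₂ primalH e))
      four-balance : ∀ p₁ q₁ r₁ s₁ p₂ q₂ r₂ s₂ → p₁ + q₁ + r₁ + s₁ ≡ p₂ + q₂ + r₂ + s₂ →
                     s₁ - s₂ ≡ ((+ 1 - p₁) - (+ 1 - p₂)) + ((+ 1 - q₁) - (+ 1 - q₂)) - (r₁ - r₂)
      four-balance p₁ q₁ r₁ s₁ p₂ q₂ r₂ s₂ eq =
        trans (regroup p₁ q₁ r₁ s₁ p₂ q₂ r₂ s₂)
              (trans (cong (λ t → t - (p₂ + q₂ + r₂ + s₂) + rhs) eq) (cancel (p₂ + q₂ + r₂ + s₂) rhs))
        where rhs : ℤ
              rhs = ((+ 1 - p₁) - (+ 1 - p₂)) + ((+ 1 - q₁) - (+ 1 - q₂)) - (r₁ - r₂)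
              regroup : ∀ p₁ q₁ r₁ s₁ p₂ q₂ r₂ s₂ → s₁ - s₂ ≡
                          (p₁ + q₁ + r₁ + s₁) - (p₂ + q₂ + r₂ + s₂)
                          + (((+ 1 - p₁) - (+ 1 - p₂)) + ((+ 1 - q₁) - (+ 1 - q₂)) - (r₁ - r₂))
              regroup = solve-∀
              cancel : ∀ t r → t - t + r ≡ r
              cancel = solve-∀

    open Potential M δp vertex-balanced using (P; between-sum)

    κ : Dart M → ℤ
    κ d = P d + P d + δp d - δd d

    ∂κ : Dart M → ℤ
    ∂κ d = κ d - κ (α d)

    count-between : Orientation M → Dart M → Dart M → ℤ
    count-between O a b = + countL (λ d → not (O primalH d)) (between M n a b)

    count-between-diff : ∀ a b → vert a ≡ vert b →
                         count-between O₁ a b - count-between O₂ a b ≡ P b - P a - δp a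
    count-between-diff a b a~b =
      trans (cong₂ _-_ (count-ΣL _ (between M n a b)) (count-ΣL _ (between M n a b)))
            (trans (ΣL-- _ _ (between M n a b)) (between-sum a b a~b))

    γstep-diff : ∀ p c → vert (α p) ≡ vert c →
                 γstep M O₁ (p , c) - γstep M O₂ (p , c) ≡ (κ c + δd (α c)) - (κ (α p) + δd (α p))
    γstep-diff p c αp~c = begin
        γstep M O₁ (p , c) - γstep M O₂ (p , c)
      ≡⟨ cong₂ _-_ (γstep-split O₁) (γstep-split O₂) ⟩
        ((count-between O₁ (α p) c + + b2n (O₁ dualH (α c))) - (count-between O₁ c (α p) + + b2n (O₁ dualH c)))
        - ((count-between O₂ (α p) c + + b2n (O₂ dualH (α c))) - (count-between O₂ c (α p) + + b2n (O₂ dualH c)))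
      ≡⟨ regroup (count-between O₁ (α p) c) (count-between O₂ (α p) c) (+ b2n (O₁ dualH (α c))) (+ b2n (O₂ dualH (α c)))
                 (count-between O₁ c (α p)) (count-between O₂ c (α p)) (+ b2n (O₁ dualH c)) (+ b2n (O₂ dualH c)) ⟩
        ((count-between O₁ (α p) c - count-between O₂ (α p) c) + δd (α c))
        - ((count-between O₁ c (α p) - count-between O₂ c (α p)) + δd c)
      ≡⟨ cong₂ (λ s t → (s + δd (α c)) - (t + δd c)) (count-between-diff (α p) c αp~c)
                                                      (count-between-diff c (α p) (sym αp~c)) ⟩
        ((P c - P (α p) - δp (α p)) + δd (α c)) - ((P (α p) - P c - δp c) + δd c)
      ≡⟨ collect (P c) (P (α p)) (δp c) (δp (α p)) (δd c) (δd (α c)) (δd (α p)) ⟩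
        (κ c + δd (α c)) - (κ (α p) + δd (α p)) ∎
      where
      open ≡-Reasoning
      γstep-split : ∀ O → γstep M O (p , c) ≡
                    (count-between O (α p) c + + b2n (O dualH (α c))) - (count-between O c (α p) + + b2n (O dualH c))
      γstep-split O = cong₂ _-_ (ℤ.pos-+ (outgoing O (α p) c) (b2n (O dualH (α c))))
                                (ℤ.pos-+ (outgoing O c (α p)) (b2n (O dualH c)))
        where outgoing : Orientation M → Dart M → Dart M → ℕ
              outgoing O a b = countL (λ d → not (O primalH d)) (between M n a b)
      regroup : ∀ r₁ r₂ a₁ a₂ s₁ s₂ b₁ b₂ → ((r₁ + a₁) - (s₁ + b₁)) - ((r₂ + a₂) - (s₂ + b₂))
                                            ≡ ((r₁ - r₂) + (a₁ - a₂)) - ((s₁ - s₂) + (b₁ - b₂))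
      regroup = solve-∀
      collect : ∀ Pc Pa pc pa dc dαc da → ((Pc - Pa - pa) + dαc) - ((Pa - Pc - pc) + dc)
                                          ≡ ((Pc + Pc + pc - dc) + dαc) - ((Pa + Pa + pa - da) + da)
      collect = solve-∀

    Δγ-walk : ∀ w → IsClosedWalk M w → γ M O₁ w - γ M O₂ w ≡ ΣL ∂κ w
    Δγ-walk w closed = begin
        γ M O₁ w - γ M O₂ w
      ≡⟨ ΣL-- (γstep M O₁) (γstep M O₂) (cycPairs w) ⟩
        ΣL (λ pc → γstep M O₁ pc - γstep M O₂ pc) (cycPairs w)
      ≡⟨ ΣL-cong-All closed (λ pc αp~c → γstep-diff (proj₁ pc) (proj₂ pc) αp~c) ⟩
        ΣL (λ pc → (κ (proj₂ pc) + δd (α (proj₂ pc))) - (κ (α (proj₁ pc)) + δd (α (proj₁ pc)))) (cycPairs w)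
      ≡⟨ ΣL-cycPairs (λ d → κ d + δd (α d)) (λ d → κ (α d) + δd (α d)) w ⟩
        ΣL (λ d → (κ d + δd (α d)) - (κ (α d) + δd (α d))) w
      ≡⟨ ΣL-cong (λ d → cancel (κ d) (κ (α d)) (δd (α d))) w ⟩
        ΣL ∂κ w ∎
      where
      open ≡-Reasoning
      cancel : ∀ x y e → (x + e) - (y + e) ≡ x - y
      cancel = solve-∀

    pairing-flow : ∀ w → ⟨ flow M w , κ ⟩ ≡ ΣL ∂κ w
    pairing-flow w = trans (⟨⟩-antisym n α αα (λ d → + countOcc M d w) κ) (sum-occurrences n w ∂κ)

    -- across an edge the potential changes by one step of the counterclockwise
    -- facial walk:  α d = σ (φ d), so nothing lies strictly between φ d and α d
    P-across : ∀ d → P (α d) ≡ P (φ M d) + δp (φ M d)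
    P-across d = ℤ.i-j≡0⇒i≡j _ _ (trans (regroup (P (α d)) (P (φ M d)) (δp (φ M d)))
                   (trans (sym (between-sum (φ M d) (α d) φd~αd)) nothing-between))
      where
      φd~αd : vert (φ M d) ≡ vert (α d)
      φd~αd = trans (sym (vert-iter 1 (φ M d))) (cong vert (σσ' (α d)))
      nothing-between : ΣL δp (between M n (φ M d) (α d)) ≡ + 0
      nothing-between = trans (cong (λ b → ΣL δp (between M n (φ M d) b)) (sym (σσ' (α d))))
                              (cong (ΣL δp) (between-σ (φ M d)))
      regroup : ∀ a b c → a - (b + c) ≡ a - b - c
      regroup = solve-∀

    h : Dart M → ℤ
    h d = P d + δp d

    ν : Dart M → ℤ
    ν d = (h d - h (φ M d)) - δd d

    ∂κ-facial : ∀ d → ∂κ d ≡ ν d + ν d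
    ∂κ-facial d = substitute (edge-balanced d) (P-across d)
      where
      substitute : ∀ {Pα dα} → dα ≡ δp d + δp (α d) - δd d → Pα ≡ P (φ M d) + δp (φ M d) →
                   κ d - (Pα + Pα + δp (α d) - dα) ≡ ν d + ν d
      substitute refl refl = identity (P d) (P (φ M d)) (δp d) (δp (α d)) (δp (φ M d)) (δd d)
        where identity : ∀ Pd Pφ pd pα pφ dd →
                         (Pd + Pd + pd - dd) - ((Pφ + pφ) + (Pφ + pφ) + pα - (pd + pα - dd))
                         ≡ ((Pd + pd) - (Pφ + pφ) - dd) + ((Pd + pd) - (Pφ + pφ) - dd)
              identity = solve-∀

    -- κ is orthogonal to every facial flow: along a face the steps of h telescope,
    -- and δd sums to zero around the face
    facial-orthogonal : ∀ f → ⟨ facialFlow M f , κ ⟩ ≡ + 0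
    facial-orthogonal f = begin
        ⟨ facialFlow M f , κ ⟩
      ≡⟨ ⟨⟩-antisym n α αα I κ ⟩
        ⟨ I , ∂κ ⟩
      ≡⟨ sum-cong n (λ d → cong (I d *_) (∂κ-facial d)) ⟩
        ⟨ I , (λ d → ν d + ν d) ⟩
      ≡⟨ trans (sum-cong n (λ d → ℤ.*-distribˡ-+ (I d) (ν d) (ν d))) (sum-+ n _ _) ⟩
        ⟨ I , ν ⟩ + ⟨ I , ν ⟩
      ≡⟨ cong (λ s → s + s) face-sum ⟩
        + 0 ∎
      where
      open ≡-Reasoning
      I : Dart M → ℤ
      I d = ind (face d) f
      I-φ : ∀ d → I (φ M d) ≡ I d
      I-φ d = cong (λ x → ind x f) (sym (Equivalence.from (face-orbit d (φ M d)) (1 , refl)))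
      Ih : Dart M → ℤ
      Ih d = I d * h d
      φ⁻¹ : Dart M → Dart M
      φ⁻¹ d = α (σ d)
      step : ∀ d → I d * ν d ≡ (Ih d - Ih (φ M d)) - I d * δd d
      step d = distrib (I-φ d) (h d) (h (φ M d)) (δd d)
        where distrib : ∀ {i i'} → i' ≡ i → ∀ x y z → i * ((x - y) - z) ≡ (i * x - i' * y) - i * z
              distrib {i} refl = identity i
                where identity : ∀ i x y z → i * ((x - y) - z) ≡ (i * x - i * y) - i * z
                      identity = solve-∀
      face-sum : ⟨ I , ν ⟩ ≡ + 0
      face-sum = begin
          ⟨ I , ν ⟩
        ≡⟨ trans (sum-cong n step) (trans (sum-- n _ _) (cong₂ _-_ (sum-- n _ _) (face-balanced f))) ⟩
          (sumFin n Ih - sumFin n (Ih ∘ φ M)) - + 0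
        ≡⟨ cong (λ s → (sumFin n Ih - s) - + 0) (sum-permute n (φ M) φ⁻¹ φφ⁻¹ φ⁻¹φ Ih) ⟩
          (sumFin n Ih - sumFin n Ih) - + 0
        ≡⟨ cancel (sumFin n Ih) ⟩
          + 0 ∎
        where
        φφ⁻¹ : ∀ d → φ M (φ⁻¹ d) ≡ d
        φφ⁻¹ d = trans (cong σ' (αα (σ d))) (σ'σ d)
        φ⁻¹φ : ∀ d → φ⁻¹ (φ M d) ≡ d
        φ⁻¹φ d = trans (cong α (σσ' (α d))) (αα d)
        cancel : ∀ s → (s - s) - + 0 ≡ + 0
        cancel = solve-∀

    Δγ≡pairing : ∀ w → IsClosedWalk M w → γ M O₁ w - γ M O₂ w ≡ ⟨ flow M w , κ ⟩
    Δγ≡pairing w closed = trans (Δγ-walk w closed) (sym (pairing-flow w))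

    -- If γ O₁ and γ O₂ agree on a homology basis, they agree on every
    -- closed walk.  Its flow is a combination of basis flows and facial flows,
    -- and κ is orthogonal to both kinds.
    γ-agrees : ∀ g (B : Fin (2 ℕ.* g) → List (Dart M)) → IsCycleBasis M g B → SameType M g O₁ O₂ B →
               ∀ w → IsClosedWalk M w → γ M O₁ w ≡ γ M O₂ w
    γ-agrees g B (B-cycles , B-spans) same-B w closed with B-spans w closed
    ... | cB , cF , decomposition = ℤ.i-j≡0⇒i≡j _ _ (begin
        γ M O₁ w - γ M O₂ w
      ≡⟨ Δγ≡pairing w closed ⟩
        ⟨ flow M w , κ ⟩
      ≡⟨ ⟨⟩-cong κ decomposition ⟩
        ⟨ (λ d → basis-part d + facial-part d) , κ ⟩
      ≡⟨ ⟨⟩-+ basis-part facial-part κ ⟩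
        ⟨ basis-part , κ ⟩ + ⟨ facial-part , κ ⟩
      ≡⟨ cong₂ _+_ (⟨⟩-combination-zero (2 ℕ.* g) cB (λ j → flow M (B j)) κ basis-orthogonal)
                   (⟨⟩-combination-zero F cF (facialFlow M) κ facial-orthogonal) ⟩
        + 0 ∎)
      where
      open ≡-Reasoning
      basis-part facial-part : Dart M → ℤ
      basis-part d = sumFin (2 ℕ.* g) (λ j → cB j * flow M (B j) d)
      facial-part d = sumFin F (λ f → cF f * facialFlow M f d)
      basis-orthogonal : ∀ j → ⟨ flow M (B j) , κ ⟩ ≡ + 0
      basis-orthogonal j =
        trans (sym (Δγ≡pairing (B j) (cycle-closed M (B-cycles j)))) (ℤ.i≡j⇒i-j≡0 (same-B j))

open import Data.Nat using (ℕ; _*_)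
open import Data.Fin using (Fin)
open import Data.List using (List)
open import Data.Product using (_,_)
open Proof using (module Comparison; cycle-closed)

lemma29 : (M : Map) (g : ℕ) → Genus M g →
          (O₁ O₂ : Orientation M) → Schnyder M O₁ → Schnyder M O₂ →
          SameOutdeg M O₁ O₂ →
          (B : Fin (2 * g) → List (Dart M)) → IsCycleBasis M g B →
          SameType M g O₁ O₂ B →
          (B' : Fin (2 * g) → List (Dart M)) → IsCycleBasis M g B' →
          SameType M g O₁ O₂ B'
lemma29 M g _ O₁ O₂ _ _ same-out B B-basis same-B B' (B'-cycles , _) i =
  Comparison.γ-agrees M O₁ O₂ same-out g B B-basis same-B (B' i) (cycle-closed M (B'-cycles i))
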